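{- For every (finite, simple, connected) graph $G$ and every integer $n\geq 1$, $$\beta(K_n\,\square\,G)\leq \max\{n-1,\,2\beta(G)\}.$$
   Context: $K_n$ is the complete graph on $n$ vertices. $d(v,w)$ denotes shortest-path distance. A vertex $x$ resolves $v,w$ if $d(v,x)\neq d(w,x)$; a set resolves a graph if every pair of distinct vertices is resolved by some vertex of the set; $\beta(G)$ is the minimum size of a resolving set. The cartesian product $G\,\square\,H$ has vertex set $V(G)\times V(H)$, with $(a,v)\sim(b,w)$ iff ($a=b$ and $vw\in E(H)$) or ($v=w$ and $ab\in E(G)$). -}

module Defs where

open import Data.Nat using (ℕ; zero; suc; _*_; _≤_)
open import Data.Fin using (Fin; remQuot)
open import Data.Fin.Subset using (Subset; _∈_; ∣_∣)
open import Data.Product using (Σ; ∃; ∃-syntax; _×_; _,_; proj₁; proj₂)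
open import Data.Sum using (_⊎_)
open import Relation.Binary.PropositionalEquality using (_≡_; _≢_)
open import Relation.Nullary using (¬_)

record Graph : Set₁ where
  constructor mkGraph
  field
    size : ℕ
    Adj  : Fin size → Fin size → Set

open Graph public

IsSimple : Graph → Set
IsSimple G = (∀ u v → Adj G u v → Adj G v u) × (∀ v → ¬ Adj G v v)

data Walk (G : Graph) : Fin (size G) → Fin (size G) → ℕ → Set where
  nil  : ∀ {v} → Walk G v v 0
  cons : ∀ {u v w k} → Adj G u v → Walk G v w k → Walk G u w (suc k)

Connected : Graph → Set
Connected G = ∀ u v → ∃[ k ] Walk G u v k

IsDist : (G : Graph) → Fin (size G) → Fin (size G) → ℕ → Set
IsDist G u v k = Walk G u v k × (∀ j → Walk G u v j → k ≤ j)

Resolves : (G : Graph) → Fin (size G) → Fin (size G) → Fin (size G) → Set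
Resolves G x v w = ∀ k l → IsDist G v x k → IsDist G w x l → k ≢ l

Resolving : (G : Graph) → Subset (size G) → Set
Resolving G S = ∀ v w → v ≢ w → ∃[ x ] (x ∈ S × Resolves G x v w)

IsMetricDim : Graph → ℕ → Set
IsMetricDim G b =
  (∃[ S ] (Resolving G S × ∣ S ∣ ≡ b)) × (∀ S → Resolving G S → b ≤ ∣ S ∣)

K : ℕ → Graph
K n = mkGraph n (λ i j → i ≢ j)

_□_ : Graph → Graph → Graph
G □ H = mkGraph (size G * size H) adj
  where
  adj : Fin (size G * size H) → Fin (size G * size H) → Set
  adj p q =
    let (a , v) = remQuot {size G} (size H) p
        (b , w) = remQuot {size G} (size H) q
    in (a ≡ b × Adj H v w) ⊎ (v ≡ w × Adj G a b)

-- Let S be a metric basis of G with b elements and write the vertices of K n □ G as pairs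
-- (a , v), so that d((a , v) , (c , s)) = [a ≠ c] + d_G(v , s). Put copies of the j-th vertex
-- of S into the layers 2j and 2j+1 (mod n), and a fixed vertex v₀ into each of the layers
-- 2b, …, n-2. These are at most max(n-1, 2b) vertices, every layer but the last one is hit,
-- and for n ≥ 2 each vertex of S has copies in two different layers. Two vertices (a , v) and
-- (b , v) with a ≠ b are separated by a chosen vertex in whichever of the layers a, b is not
-- the last one. Two vertices (a , v) and (b , w) with v ≠ w are separated by some s ∈ S, say
-- d(v , s) < d(w , s); unless a = b, one of the two copies of s lies outside layer b, and
-- that copy is strictly closer to (a , v) than to (b , w).
--
-- Since adjacency is an arbitrary type, distances in G exist
-- only up to double negation; this suffices because the conclusion is a decidable inequality.

{-# OPTIONS --safe #-}
module Submission where

open import Defs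
open import Data.Nat using (ℕ; _≤_; _⊔_; _*_; _∸_)
open import Data.Nat.Base using (zero; suc; _+_; _<_; z≤n; s≤s; NonZero)
open import Data.Nat.Properties hiding (_≟_)
open import Data.Nat.DivMod using (_%_; _/_; _mod_; m≡m%n+[m/n]*n; m<n⇒m%n≡m)
open import Data.Nat.Divisibility using (_∣_; divides; ∣m+n∣m⇒∣n; n∣m*n; ∣1⇒≡1)
open import Data.Nat.Induction using (<-rec)
open import Data.Fin.Base as Fin using (Fin; combine; remQuot; toℕ; fromℕ<; splitAt; _↑ˡ_)
open import Data.Fin.Patterns using (0F; 1F)
open import Data.Fin.Properties
  using (_≟_; ¬Fin0; toℕ-injective; toℕ-fromℕ<; toℕ≤pred[n]; toℕ<n; toℕ-↑ˡ; toℕ-combine;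
         splitAt-↑ˡ; remQuot-combine; combine-remQuot; sequence)
open import Data.Fin.Subset as Subset using (Subset; _∈_; ∣_∣; ⁅_⁆; _∪_; inside; outside)
open import Data.Fin.Subset.Properties using (x∈⁅x⁆; x∈p∪q⁺; ∣⁅x⁆∣≡1; ∣⊥∣≡0)
open import Data.Vec.Base using ([]; _∷_; here; there)
open import Data.Product using (∃; ∃₂; ∃-syntax; _×_; _,_; proj₁; proj₂)
open import Data.Sum as Sum using (_⊎_; inj₁; inj₂; [_,_]′)
open import Effect.Monad using (RawMonad)
open import Function using (_∘_)
open import Relation.Binary.Definitions using (tri<; tri≈; tri>)
open import Relation.Nullary using (¬_; yes; no; contradiction; contradiction₂)
open import Relation.Nullary.Negation using (¬¬-Monad; ¬¬-map)
open import Relation.Nullary.Decidable using (decidable-stable)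
open import Relation.Binary.PropositionalEquality
  using (_≡_; _≢_; refl; sym; trans; cong; subst; subst₂; ≢-sym; module ≡-Reasoning)

m+[n∸m]≡m⊔n : ∀ m n → m + (n ∸ m) ≡ m ⊔ n
m+[n∸m]≡m⊔n m n with ≤-total m n
... | inj₁ m≤n = trans (m+[n∸m]≡n m≤n) (sym (m≤n⇒m⊔n≡n m≤n))
... | inj₂ n≤m = trans (cong (m +_) (m≤n⇒m∸n≡0 n≤m)) (trans (+-identityʳ m) (sym (m≥n⇒m⊔n≡m n≤m)))

m%n≢[1+m]%n : ∀ m {n} .{{_ : NonZero n}} → 1 < n → m % n ≢ suc m % n
m%n≢[1+m]%n m {n} 1<n same = <⇒≢ 1<n (sym (∣1⇒≡1 n∣1))
  where
  open ≡-Reasoning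
  shifted : suc (m / n * n) ≡ suc m / n * n
  shifted = +-cancelˡ-≡ (m % n) _ _ (begin
    m % n + suc (m / n * n)     ≡⟨ +-suc (m % n) _ ⟩
    suc (m % n + m / n * n)     ≡⟨ cong suc (sym (m≡m%n+[m/n]*n m n)) ⟩
    suc m                       ≡⟨ m≡m%n+[m/n]*n (suc m) n ⟩
    suc m % n + suc m / n * n   ≡⟨ cong (_+ suc m / n * n) (sym same) ⟩
    m % n + suc m / n * n       ∎)
  n∣1 : n ∣ 1
  n∣1 = ∣m+n∣m⇒∣n (divides (suc m / n) (trans (+-comm (m / n * n) 1) shifted)) (n∣m*n (m / n))

Fin-≢⇒1<n : ∀ {n} {a b : Fin n} → a ≢ b → 1 < n
Fin-≢⇒1<n {suc zero}    {Fin.zero} {Fin.zero} a≢b = contradiction refl a≢b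
Fin-≢⇒1<n {suc (suc n)} _                         = s≤s (s≤s z≤n)

toℕ-mod : ∀ {n} (c : Fin (suc n)) → toℕ c mod suc n ≡ c
toℕ-mod c = toℕ-injective (trans (toℕ-fromℕ< _) (m<n⇒m%n≡m (toℕ<n c)))

≢⇒one-not-last : ∀ {n} {a b : Fin (suc n)} → a ≢ b → ∃ λ c → (c ≡ a ⊎ c ≡ b) × toℕ c < n
≢⇒one-not-last {n} {a} {b} a≢b with m≤n⇒m<n∨m≡n (toℕ≤pred[n] a) | m≤n⇒m<n∨m≡n (toℕ≤pred[n] b)
... | inj₁ a<n | _        = a , inj₁ refl , a<n
... | inj₂ _   | inj₁ b<n = b , inj₂ refl , b<n
... | inj₂ a≡n | inj₂ b≡n = contradiction (toℕ-injective (trans a≡n (sym b≡n))) a≢b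

Fin-inhabited? : ∀ n → Fin n ⊎ ¬ Fin n
Fin-inhabited? zero    = inj₂ ¬Fin0
Fin-inhabited? (suc n) = inj₁ Fin.zero

¬¬-least : ∀ {P : ℕ → Set} {j} → P j → ¬ ¬ ∃ λ k → P k × ∀ i → P i → k ≤ i
¬¬-least {P} {j} pⱼ no-least = <-rec (λ m → ¬ P m) none-below j pⱼ
  where
  none-below : ∀ m → (∀ {i} → i < m → ¬ P i) → ¬ P m
  none-below m below pₘ = no-least (m , pₘ , λ i pᵢ → ≮⇒≥ (λ i<m → below i<m pᵢ))

module _ {G : Graph} where

  IsDist-unique : ∀ {u v k l} → IsDist G u v k → IsDist G u v l → k ≡ l
  IsDist-unique (walkₖ , minₖ) (walkₗ , minₗ) = ≤-antisym (minₖ _ walkₗ) (minₗ _ walkₖ)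

  Resolves-by-IsDist : ∀ {x v w k l} → IsDist G v x k → IsDist G w x l → k ≢ l → Resolves G x v w
  Resolves-by-IsDist dv dw k≢l _ _ dv′ dw′ k′≡l′ =
    k≢l (trans (IsDist-unique dv dv′) (trans k′≡l′ (IsDist-unique dw′ dw)))

Distances : Graph → Set
Distances G = ∀ u v → ∃ (IsDist G u v)

¬¬-distances : ∀ {G} → Connected G → ¬ ¬ Distances G
¬¬-distances connected =
  sequence rawApplicative λ u → sequence rawApplicative λ v → ¬¬-least (proj₂ (connected u v))
  where open RawMonad ¬¬-Monad using (rawApplicative)

distK : ∀ {n} → Fin n → Fin n → ℕ
distK a c with a ≟ c
... | yes _ = 0
... | no  _ = 1

IsDist-K : ∀ {n} (a c : Fin n) → IsDist (K n) a c (distK a c)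
IsDist-K a c with a ≟ c
... | yes refl = nil , λ _ _ → z≤n
... | no  a≢c  = cons a≢c nil , λ { _ nil → contradiction refl a≢c ; _ (cons _ _) → s≤s z≤n }

module _ {n} {a b c : Fin n} where

  distK-≤ : b ≢ c → distK a c ≤ distK b c
  distK-≤ b≢c with a ≟ c | b ≟ c
  ... | _     | yes b≡c = contradiction b≡c b≢c
  ... | yes _ | no  _   = z≤n
  ... | no  _ | no  _   = ≤-refl

  distK-≢ : a ≢ b → c ≡ a ⊎ c ≡ b → distK a c ≢ distK b c
  distK-≢ a≢b c∈ab with a ≟ c | b ≟ c
  ... | yes a≡c | yes b≡c = contradiction (trans a≡c (sym b≡c)) a≢b
  ... | yes _   | no  _   = λ ()
  ... | no  _   | yes _   = λ ()
  ... | no  a≢c | no  b≢c = λ _ → contradiction₂ c∈ab (a≢c ∘ sym) (b≢c ∘ sym)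

distK-≤-at-one-of : ∀ {n} (a b : Fin n) {c₀ c₁ : Fin n} → (a ≢ b → c₀ ≢ c₁) →
                    distK a c₀ ≤ distK b c₀ ⊎ distK a c₁ ≤ distK b c₁
distK-≤-at-one-of a b {c₀} separated with a ≟ b
... | yes refl = inj₁ ≤-refl
... | no  a≢b  with c₀ ≟ b
...   | no  c₀≢b = inj₁ (distK-≤ (c₀≢b ∘ sym))
...   | yes refl = inj₂ (distK-≤ (separated a≢b))

distK-+-≢-at-one-of : ∀ {n} (a b : Fin n) {c₀ c₁ : Fin n} → (a ≢ b → c₀ ≢ c₁) → ∀ {k l} → k ≢ l →
                      distK a c₀ + k ≢ distK b c₀ + l ⊎ distK a c₁ + k ≢ distK b c₁ + l
distK-+-≢-at-one-of a b separated {k} {l} k≢l with <-cmp k l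
... | tri< k<l _ _ = Sum.map (λ le → <⇒≢ (+-mono-≤-< le k<l)) (λ le → <⇒≢ (+-mono-≤-< le k<l))
                             (distK-≤-at-one-of a b separated)
... | tri≈ _ k≡l _ = contradiction k≡l k≢l
... | tri> _ _ l<k = Sum.map (λ le → >⇒≢ (+-mono-≤-< le l<k)) (λ le → >⇒≢ (+-mono-≤-< le l<k))
                             (distK-≤-at-one-of b a (separated ∘ ≢-sym))

module _ {H G : Graph} where

  private
    π₁ : Fin (size H * size G) → Fin (size H)
    π₁ p = proj₁ (remQuot {size H} (size G) p)

    π₂ : Fin (size H * size G) → Fin (size G)
    π₂ p = proj₂ (remQuot {size H} (size G) p)

    AdjPair : Fin (size H) × Fin (size G) → Fin (size H) × Fin (size G) → Set
    AdjPair (a , v) (b , w) = (a ≡ b × Adj G v w) ⊎ (v ≡ w × Adj H a b)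

    combine-adj : ∀ a v b w → AdjPair (a , v) (b , w) → Adj (H □ G) (combine a v) (combine b w)
    combine-adj a v b w =
      subst₂ AdjPair (sym (remQuot-combine {size H} {size G} a v))
                     (sym (remQuot-combine {size H} {size G} b w))

  □-adjˡ : ∀ {a b} v → Adj H a b → Adj (H □ G) (combine a v) (combine b v)
  □-adjˡ {a} {b} v adj = combine-adj a v b v (inj₂ (refl , adj))

  □-adjʳ : ∀ a {v w} → Adj G v w → Adj (H □ G) (combine a v) (combine a w)
  □-adjʳ a {v} {w} adj = combine-adj a v a w (inj₁ (refl , adj))

  walk-□ʳ : ∀ a {v s g} → Walk G v s g → Walk (H □ G) (combine a v) (combine a s) g
  walk-□ʳ a nil                  = nil
  walk-□ʳ a (cons {v = v} adj w) = cons {v = combine a v} (□-adjʳ a adj) (walk-□ʳ a w)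

  walk-□ : ∀ {a c v s i g} → Walk H a c i → Walk G v s g →
           Walk (H □ G) (combine a v) (combine c s) (i + g)
  walk-□ {a}     nil                   w = walk-□ʳ a w
  walk-□ {v = v} (cons {v = b} adj wH) w = cons {v = combine b v} (□-adjˡ v adj) (walk-□ wH w)

  walk-π : ∀ {p q j} → Walk (H □ G) p q j →
           ∃₂ λ i g → Walk H (π₁ p) (π₁ q) i × Walk G (π₂ p) (π₂ q) g × i + g ≡ j
  walk-π nil = 0 , 0 , nil , nil , refl
  walk-π (cons (inj₁ (a≡b , adj)) w) with walk-π w
  ... | i , g , wH , wG , i+g≡j =
    i , suc g , subst (λ a → Walk H a _ i) (sym a≡b) wH , cons adj wG , trans (+-suc i g) (cong suc i+g≡j)
  walk-π (cons (inj₂ (v≡w , adj)) w) with walk-π w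
  ... | i , g , wH , wG , i+g≡j =
    suc i , g , cons adj wH , subst (λ v → Walk G v _ g) (sym v≡w) wG , cong suc i+g≡j

  IsDist-□ : ∀ {a c v s i g} → IsDist H a c i → IsDist G v s g →
             IsDist (H □ G) (combine a v) (combine c s) (i + g)
  IsDist-□ {a} {c} {v} {s} {i} {g} (wH , minH) (wG , minG) = walk-□ wH wG , shortest
    where
    shortest : ∀ j → Walk (H □ G) (combine a v) (combine c s) j → i + g ≤ j
    shortest j w with walk-π w
    ... | i′ , g′ , wH′ , wG′ , refl =
      +-mono-≤ (minH i′ (subst₂ (λ x y → Walk H x y i′) (cong proj₁ av) (cong proj₁ cs) wH′))
               (minG g′ (subst₂ (λ x y → Walk G x y g′) (cong proj₂ av) (cong proj₂ cs) wG′))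
      where
      av : remQuot (size G) (combine a v) ≡ (a , v)
      av = remQuot-combine a v
      cs : remQuot (size G) (combine c s) ≡ (c , s)
      cs = remQuot-combine c s

  Resolving-□ : ∀ W → (∀ a v b w → combine a v ≢ combine b w →
                        ∃[ x ] (x ∈ W × Resolves (H □ G) x (combine a v) (combine b w))) →
                Resolving (H □ G) W
  Resolving-□ W resolve p q p≢q =
    subst₂ Resolved p≡av q≡bw (resolve (π₁ p) (π₂ p) (π₁ q) (π₂ q) (p≢q ∘ subst₂ _≡_ p≡av q≡bw))
    where
    Resolved : Fin (size H * size G) → Fin (size H * size G) → Set
    Resolved p q = ∃[ x ] (x ∈ W × Resolves (H □ G) x p q)
    p≡av : combine (π₁ p) (π₂ p) ≡ p
    p≡av = combine-remQuot {size H} (size G) p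
    q≡bw : combine (π₁ q) (π₂ q) ≡ q
    q≡bw = combine-remQuot {size H} (size G) q

∣p∪q∣≤∣p∣+∣q∣ : ∀ {N} (p q : Subset N) → ∣ p ∪ q ∣ ≤ ∣ p ∣ + ∣ q ∣
∣p∪q∣≤∣p∣+∣q∣ []            []            = z≤n
∣p∪q∣≤∣p∣+∣q∣ (outside ∷ p) (outside ∷ q) = ∣p∪q∣≤∣p∣+∣q∣ p q
∣p∪q∣≤∣p∣+∣q∣ (outside ∷ p) (inside  ∷ q) = ≤-trans (s≤s (∣p∪q∣≤∣p∣+∣q∣ p q)) (≤-reflexive (sym (+-suc _ _)))
∣p∪q∣≤∣p∣+∣q∣ (inside  ∷ p) (outside ∷ q) = s≤s (∣p∪q∣≤∣p∣+∣q∣ p q)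
∣p∪q∣≤∣p∣+∣q∣ (inside  ∷ p) (inside  ∷ q) = s≤s (≤-trans (∣p∪q∣≤∣p∣+∣q∣ p q) (+-monoʳ-≤ ∣ p ∣ (n≤1+n _)))

image : ∀ {m N} → (Fin m → Fin N) → Subset N
image {zero}  f = Subset.⊥
image {suc m} f = ⁅ f Fin.zero ⁆ ∪ image (f ∘ Fin.suc)

∈-image : ∀ {m N} (f : Fin m → Fin N) i → f i ∈ image f
∈-image f Fin.zero    = x∈p∪q⁺ (inj₁ (x∈⁅x⁆ _))
∈-image f (Fin.suc i) = x∈p∪q⁺ {p = ⁅ f Fin.zero ⁆} (inj₂ (∈-image (f ∘ Fin.suc) i))

∣image∣≤ : ∀ {m N} (f : Fin m → Fin N) → ∣ image f ∣ ≤ m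
∣image∣≤ {zero}  {N} f = ≤-reflexive (∣⊥∣≡0 N)
∣image∣≤ {suc m}     f = begin
  ∣ ⁅ f Fin.zero ⁆ ∪ image (f ∘ Fin.suc) ∣       ≤⟨ ∣p∪q∣≤∣p∣+∣q∣ ⁅ f Fin.zero ⁆ _ ⟩
  ∣ ⁅ f Fin.zero ⁆ ∣ + ∣ image (f ∘ Fin.suc) ∣   ≡⟨ cong (_+ ∣ image (f ∘ Fin.suc) ∣) (∣⁅x⁆∣≡1 (f Fin.zero)) ⟩
  suc ∣ image (f ∘ Fin.suc) ∣                   ≤⟨ s≤s (∣image∣≤ (f ∘ Fin.suc)) ⟩
  suc m                                         ∎
  where open ≤-Reasoning

enumerate : ∀ {N} (p : Subset N) → Fin ∣ p ∣ → Fin N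
enumerate (inside  ∷ p) Fin.zero    = Fin.zero
enumerate (inside  ∷ p) (Fin.suc j) = Fin.suc (enumerate p j)
enumerate (outside ∷ p) j           = Fin.suc (enumerate p j)

enumerate-onto : ∀ {N} {p : Subset N} {x} → x ∈ p → ∃ λ j → enumerate p j ≡ x
enumerate-onto {p = inside  ∷ p} here = Fin.zero , refl
enumerate-onto {p = inside  ∷ p} (there x∈p) with enumerate-onto x∈p
... | j , refl = Fin.suc j , refl
enumerate-onto {p = outside ∷ p} (there x∈p) with enumerate-onto x∈p
... | j , refl = j , refl

module Layout (G : Graph) (n′ : ℕ) (S : Subset (size G)) (v₀ : Fin (size G)) where

  n : ℕ
  n = suc n′

  P : Graph
  P = K n □ G

  b : ℕ
  b = ∣ S ∣

  positions : ℕ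
  positions = b * 2 + (n′ ∸ b * 2)

  -- Position t lies in layer t mod n. For t < 2b its vertex is the ⌊t/2⌋-th vertex of S,
  -- otherwise it is v₀.
  base : Fin positions → Fin (size G)
  base t = [ enumerate S ∘ proj₁ ∘ remQuot 2 , (λ _ → v₀) ]′ (splitAt (b * 2) t)

  place : Fin positions → Fin (size P)
  place t = combine (toℕ t mod n) (base t)

  W : Subset (size P)
  W = image place

  ∣W∣≤ : ∣ W ∣ ≤ n′ ⊔ 2 * b
  ∣W∣≤ = begin
    ∣ image place ∣           ≤⟨ ∣image∣≤ place ⟩
    positions                 ≡⟨⟩
    b * 2 + (n′ ∸ b * 2)      ≡⟨ m+[n∸m]≡m⊔n (b * 2) n′ ⟩
    b * 2 ⊔ n′                ≡⟨ ⊔-comm (b * 2) n′ ⟩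
    n′ ⊔ b * 2                ≡⟨ cong (n′ ⊔_) (*-comm b 2) ⟩
    n′ ⊔ 2 * b                ∎
    where open ≤-Reasoning

  layer-meets-W : ∀ c → toℕ c < n′ → ∃ λ y → combine c y ∈ W
  layer-meets-W c c<n′ = base t , subst (λ c′ → combine c′ (base t) ∈ W) layer≡c (∈-image place t)
    where
    t<m : toℕ c < positions
    t<m = <-≤-trans c<n′ (m≤n+m∸n n′ (b * 2))
    t : Fin positions
    t = fromℕ< t<m
    layer≡c : toℕ t mod n ≡ c
    layer≡c = trans (cong (_mod n) (toℕ-fromℕ< t<m)) (toℕ-mod c)

  landmark-layer : Fin b → Fin 2 → Fin n
  landmark-layer j ε = toℕ (combine j ε) mod n

  landmark∈W : ∀ j ε → combine (landmark-layer j ε) (enumerate S j) ∈ W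
  landmark∈W j ε = subst₂ (λ c y → combine c y ∈ W) layer≡ base≡ (∈-image place t)
    where
    t : Fin positions
    t = combine j ε ↑ˡ (n′ ∸ b * 2)
    layer≡ : toℕ t mod n ≡ landmark-layer j ε
    layer≡ = cong (_mod n) (toℕ-↑ˡ (combine j ε) _)
    base≡ : base t ≡ enumerate S j
    base≡ = trans (cong [ enumerate S ∘ proj₁ ∘ remQuot 2 , (λ _ → v₀) ]′
                        (splitAt-↑ˡ (b * 2) (combine j ε) _))
                  (cong (enumerate S ∘ proj₁) (remQuot-combine j ε))

  landmark-layers-differ : ∀ j → 1 < n → landmark-layer j 0F ≢ landmark-layer j 1F
  landmark-layers-differ j 1<n same = m%n≢[1+m]%n x 1<n (begin
    x % n                              ≡⟨ toℕ-fromℕ< _ ⟨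
    toℕ (landmark-layer j 0F)          ≡⟨ cong toℕ same ⟩
    toℕ (landmark-layer j 1F)          ≡⟨ toℕ-fromℕ< _ ⟩
    toℕ (combine j 1F) % n             ≡⟨ cong (_% n) next ⟩
    suc x % n                          ∎)
    where
    open ≡-Reasoning
    x : ℕ
    x = toℕ (combine j 0F)
    next : toℕ (combine j 1F) ≡ suc x
    next = trans (toℕ-combine j 1F) (trans (+-suc (2 * toℕ j) 0) (cong suc (sym (toℕ-combine j 0F))))

  module _ (S-resolving : Resolving G S) (dists : Distances G) where

    d : Fin (size G) → Fin (size G) → ℕ
    d v s = proj₁ (dists v s)

    resolves-by-distK : ∀ {a v b w c s} → distK a c + d v s ≢ distK b c + d w s →
                        Resolves P (combine c s) (combine a v) (combine b w)
    resolves-by-distK {a} {v} {b} {w} {c} {s} =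
      Resolves-by-IsDist (IsDist-□ (IsDist-K a c) (proj₂ (dists v s)))
                         (IsDist-□ (IsDist-K b c) (proj₂ (dists w s)))

    resolve-layers : ∀ a b v → a ≢ b → ∃[ x ] (x ∈ W × Resolves P x (combine a v) (combine b v))
    resolve-layers a b v a≢b with ≢⇒one-not-last a≢b
    ... | c , c∈ab , c<n′ with layer-meets-W c c<n′
    ...   | y , cy∈W = combine c y , cy∈W , resolves-by-distK (distK-≢ a≢b c∈ab ∘ +-cancelʳ-≡ (d v y) _ _)

    resolve-bases : ∀ a b {v w} → v ≢ w → ∃[ x ] (x ∈ W × Resolves P x (combine a v) (combine b w))
    resolve-bases a b {v} {w} v≢w with S-resolving v w v≢w
    ... | s , s∈S , s-resolves with enumerate-onto s∈S
    ... | j , refl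
      with distK-+-≢-at-one-of a b (landmark-layers-differ j ∘ Fin-≢⇒1<n)
                                   (s-resolves _ _ (proj₂ (dists v s)) (proj₂ (dists w s)))
    ...   | inj₁ ≢₀ = _ , landmark∈W j 0F , resolves-by-distK ≢₀
    ...   | inj₂ ≢₁ = _ , landmark∈W j 1F , resolves-by-distK ≢₁

    W-resolving : Resolving P W
    W-resolving = Resolving-□ {K n} {G} W resolve
      where
      resolve : ∀ a v b w → combine a v ≢ combine b w →
                ∃[ x ] (x ∈ W × Resolves P x (combine a v) (combine b w))
      resolve a v b w av≢bw with v ≟ w
      ... | no  v≢w  = resolve-bases a b v≢w
      ... | yes refl = resolve-layers a b v (av≢bw ∘ cong (λ c → combine c v))

lemma5p2 : (G : Graph) → IsSimple G → Connected G →
    (n : ℕ) → 1 ≤ n →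
    (bG bP : ℕ) → IsMetricDim G bG → IsMetricDim (K n □ G) bP →
    bP ≤ (n ∸ 1) ⊔ (2 * bG)
lemma5p2 G _ connected (suc n′) _ _ bP ((S , S-resolving , refl) , _) (_ , minimal) with Fin-inhabited? (size G)
... | inj₂ no-vertex =
  ≤-trans (minimal Subset.⊥ (λ p → contradiction (proj₂ (remQuot {suc n′} (size G) p)) no-vertex))
          (≤-trans (≤-reflexive (∣⊥∣≡0 (suc n′ * size G))) z≤n)
... | inj₁ v₀ = decidable-stable (bP ≤? n′ ⊔ 2 * ∣ S ∣) (¬¬-map bound (¬¬-distances connected))
  where
  open Layout G n′ S v₀
  bound : Distances G → bP ≤ n′ ⊔ 2 * ∣ S ∣
  bound dists = ≤-trans (minimal W (W-resolving S-resolving dists)) ∣W∣≤
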